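{- Let $Q_4$ be the $4$-dimensional hypercube graph and let $\mathcal{E}_3$ be the scramble on $Q_4$ whose eggs are exactly the vertex sets of size $3$ inducing connected subgraphs. Then $\|\mathcal{E}_3\|=8$.
   Context: $Q_n$ has vertex set $\{0,1\}^n$, two vertices adjacent iff they differ in exactly one coordinate. For a scramble (collection of nonempty vertex sets inducing connected subgraphs, called eggs) $\mathcal{S}$: $h(\mathcal{S})$ is the minimum size of a vertex set meeting every egg; an egg-cut is $A\subseteq V$ with both $A$ and $A^C$ containing an egg, of size $|E(A,A^C)|$ (number of edges between $A$ and $A^C$); $e(\mathcal{S})$ is the minimum size of an egg-cut ($\infty$ if none); $\|\mathcal{S}\|=\min(h(\mathcal{S}),e(\mathcal{S}))$. -}

module Defs where

open import Data.Bool using (Bool; true; false; if_then_else_; not)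
open import Data.Nat using (ℕ; zero; suc; _+_; _≤_)
open import Data.Vec using (Vec; []; _∷_)
open import Data.List using (List; []; _∷_; map; _++_)
open import Data.Nat.ListAction using (sum)
open import Data.Product using (Σ; ∃; _×_; _,_)
open import Data.Sum using (_⊎_)
open import Relation.Binary.PropositionalEquality using (_≡_)
open import Level using (Level; suc; _⊔_) renaming (zero to lzero)

Vertex : ℕ → Set
Vertex n = Vec Bool n

allVertices : (n : ℕ) → List (Vertex n)
allVertices zero = [] ∷ []
allVertices (suc n) = map (true ∷_) (allVertices n) ++ map (false ∷_) (allVertices n)

bdiff : Bool → Bool → ℕ
bdiff true  true  = 0
bdiff false false = 0
bdiff _     _     = 1

hamming : {n : ℕ} → Vertex n → Vertex n → ℕ
hamming [] [] = 0
hamming (a ∷ u) (b ∷ v) = bdiff a b + hamming u v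

Adj : {n : ℕ} → Vertex n → Vertex n → Set
Adj u v = hamming u v ≡ 1

VSet : ℕ → Set
VSet n = Vertex n → Bool

_∈V_ : {n : ℕ} → Vertex n → VSet n → Set
v ∈V X = X v ≡ true

_⊆V_ : {n : ℕ} → VSet n → VSet n → Set
X ⊆V Y = ∀ v → v ∈V X → v ∈V Y

complement : {n : ℕ} → VSet n → VSet n
complement A v = not (A v)

count : {n : ℕ} → (Vertex n → Bool) → ℕ
count {n} f = sum (map (λ v → if f v then 1 else 0) (allVertices n))

size : {n : ℕ} → VSet n → ℕ
size X = count X

cutSize : {n : ℕ} → VSet n → ℕ
cutSize {n} A =
  sum (map (λ u → if A u
                  then count (λ v → if A v then false
                                    else hammingIs1 u v)
                  else 0) (allVertices n))
  where
  hammingIs1 : Vertex n → Vertex n → Bool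
  hammingIs1 u v with hamming u v
  ... | 1 = true
  ... | _ = false

data WalkIn {n : ℕ} (X : VSet n) : Vertex n → Vertex n → Set where
  here : ∀ {v} → v ∈V X → WalkIn X v v
  step : ∀ {u w v} → u ∈V X → Adj u w → WalkIn X w v → WalkIn X u v

InducesConnected : {n : ℕ} → VSet n → Set
InducesConnected X =
  (∃ λ v → v ∈V X) × (∀ u v → u ∈V X → v ∈V X → WalkIn X u v)

record Scramble (n : ℕ) : Set₁ where
  field
    Egg : VSet n → Set
    egg-connected : ∀ X → Egg X → InducesConnected X
open Scramble public

Hitting : {n : ℕ} → Scramble n → VSet n → Set
Hitting S T = ∀ X → Egg S X → ∃ λ v → v ∈V T × v ∈V X

EggCut : {n : ℕ} → Scramble n → VSet n → Set
EggCut S A = (∃ λ X → Egg S X × X ⊆V A) × (∃ λ Y → Egg S Y × Y ⊆V complement A)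

IsHittingNumber : {n : ℕ} → Scramble n → ℕ → Set
IsHittingNumber S k = (∃ λ T → Hitting S T × size T ≡ k) × (∀ T → Hitting S T → k ≤ size T)

-- ‖S‖ = min(h(S), e(S)) = k, where e(S) = ∞ if no egg-cut exists.
-- Since h(S) and e(S) are minima, min(h,e) is the minimum of the union
-- { |T| : T hitting } ∪ { |E(A,A^C)| : A egg-cut }.
ScrambleNorm : {n : ℕ} → Scramble n → ℕ → Set
ScrambleNorm S k =
  ((∃ λ T → Hitting S T × size T ≡ k) ⊎ (∃ λ A → EggCut S A × cutSize A ≡ k))
  × (∀ T → Hitting S T → k ≤ size T)
  × (∀ A → EggCut S A → k ≤ cutSize A)

E3 : (n : ℕ) → Scramble n
E3 n = record
  { Egg = λ X → size X ≡ 3 × InducesConnected X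
  ; egg-connected = λ X p → Data.Product.proj₂ p
  }

-- The half-cube {x | x₁ = 1} is an egg-cut with 8 edges, so it remains to show h ≥ 8 and e ≥ 8.
--
-- h ≥ 8: Q₄ is the disjoint union of the four squares {x} × Q₂. In a square every 3-subset is a
-- path, hence an egg, and a set meeting all four 3-subsets of a square contains two of its vertices
-- (checked over the 16 subsets of Q₂).
--
-- e ≥ 8: split Q₄ into two copies of Q₃ and A into its halves A₁, A₀ of sizes a, b. Every edge
-- lies in a half or joins the halves, so ∂A = ∂A₁ + ∂A₀ + |A₁ ∖ A₀| + |A₀ ∖ A₁|, and the last
-- two terms are at least a ∸ b and b ∸ a. Bounding ∂A₁, ∂A₀ by the edge-isoperimetric profile
-- of Q₃ (checked over its 256 subsets) leaves an arithmetic inequality in a and b, which holds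
-- whenever 3 ≤ a + b ≤ 13, as it is for an egg-cut.

module Submission where

open import Data.Bool using (Bool; true; false; T; not; _∧_; _∨_; if_then_else_)
open import Data.Bool.Properties using (T-∧; T-∨; T-≡; ∨-zeroʳ; if-eta; if-∧; if-not)
  renaming (_≟_ to _≟ᵇ_)
open import Data.Bool.ListAction using (all)
open import Data.List using (List; []; _∷_; map)
open import Data.List.Properties using (map-++; map-∘; map-cong)
open import Data.List.Relation.Unary.All using (All; all?) renaming (map to All-map)
open import Data.List.Relation.Unary.All.Properties using (all⁻)
open import Data.Nat using (ℕ; zero; suc; _+_; _∸_; _^_; _≤_; _<_; _≤ᵇ_; _≡ᵇ_; _≤?_; z≤n; s≤s)
open import Data.Nat.ListAction using (sum)
open import Data.Nat.ListAction.Properties using (sum-++)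
open import Data.Nat.Properties
  using ( _≟_; +-identityʳ; +-comm; +-mono-≤; +-monoʳ-≤; ≤-refl; ≤-trans; m≤m+n; m≤n+m
        ; m≤n+o⇒m∸n≤o; m+n≤o⇒m≤o∸n; ≤ᵇ⇒≤; allUpTo?; +-commutativeSemigroup; module ≤-Reasoning)
open import Algebra.Properties.CommutativeSemigroup +-commutativeSemigroup using (interchange)
open import Data.Product using (_×_; _,_; proj₁; proj₂)
open import Data.Sum using (_⊎_; inj₁; inj₂)
open import Data.Vec using ([]; _∷_; _++_)
open import Data.Vec.Properties using (≡-dec)
open import Function using (_∘_; const; Equivalence)
open import Relation.Binary.Definitions using (DecidableEquality)
open import Relation.Nullary.Decidable using (Dec; does; yes; no; dec-true; from-yes; _×-dec_; _→-dec_)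
open import Relation.Binary.PropositionalEquality
open import Defs

variable
  n : ℕ

T-not-∨ : ∀ {a b} → T (not a ∨ b) → T a → T b
T-not-∨ {true} b-holds _ = b-holds

sum-map-mono : ∀ {A : Set} {f g : A → ℕ} → (∀ x → f x ≤ g x) → ∀ xs → sum (map f xs) ≤ sum (map g xs)
sum-map-mono f≤g []       = z≤n
sum-map-mono f≤g (x ∷ xs) = +-mono-≤ (f≤g x) (sum-map-mono f≤g xs)

sum-map-+ : ∀ {A : Set} (f g : A → ℕ) xs → sum (map (λ x → f x + g x) xs) ≡ sum (map f xs) + sum (map g xs)
sum-map-+ f g []       = refl
sum-map-+ f g (x ∷ xs) = trans (cong (f x + g x +_) (sum-map-+ f g xs)) (interchange (f x) (g x) _ _)

sum-map-cong : ∀ {A : Set} {f g : A → ℕ} → (∀ x → f x ≡ g x) → ∀ xs → sum (map f xs) ≡ sum (map g xs)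
sum-map-cong f≗g xs = cong sum (map-cong f≗g xs)

sum-allVertices-suc : (F : Vertex (suc n) → ℕ) →
  sum (map F (allVertices (suc n)))
    ≡ sum (map (F ∘ (true ∷_)) (allVertices n)) + sum (map (F ∘ (false ∷_)) (allVertices n))
sum-allVertices-suc {n} F =
  trans (cong sum (map-++ F (map (true ∷_) vs) (map (false ∷_) vs)))
    (trans (sum-++ (map F (map (true ∷_) vs)) _)
      (sym (cong₂ _+_ (cong sum (map-∘ vs)) (cong sum (map-∘ vs)))))
  where vs = allVertices n

count-suc : (f : Vertex (suc n) → Bool) → count f ≡ count (f ∘ (true ∷_)) + count (f ∘ (false ∷_))
count-suc f = sum-allVertices-suc (λ v → if f v then 1 else 0)

count-false : {f : Vertex n → Bool} → (∀ v → f v ≡ false) → count f ≡ 0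
count-false {zero}  f≡false rewrite f≡false [] = refl
count-false {suc n} {f} f≡false =
  trans (count-suc f) (cong₂ _+_ (count-false (f≡false ∘ (true ∷_))) (count-false (f≡false ∘ (false ∷_))))

count-mono : {X Y : VSet n} → X ⊆V Y → count X ≤ count Y
count-mono {zero} {X} X⊆Y with X [] in X[]
... | false = z≤n
... | true  rewrite X⊆Y [] X[] = ≤-refl
count-mono {suc n} {X} {Y} X⊆Y = begin
  count X                                         ≡⟨ count-suc X ⟩
  count (X ∘ (true ∷_)) + count (X ∘ (false ∷_))  ≤⟨ +-mono-≤ (count-mono (X⊆Y ∘ (true ∷_)))
                                                               (count-mono (X⊆Y ∘ (false ∷_))) ⟩
  count (Y ∘ (true ∷_)) + count (Y ∘ (false ∷_))  ≡⟨ count-suc Y ⟨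
  count Y                                         ∎
  where open ≤-Reasoning

count-prefix : ∀ k {m} (f : Vertex (k + m) → Bool) →
  count f ≡ sum (map (λ x → count (λ v → f (x ++ v))) (allVertices k))
count-prefix zero    f = sym (+-identityʳ _)
count-prefix (suc k) f =
  trans (count-suc f)
    (trans (cong₂ _+_ (count-prefix k (f ∘ (true ∷_))) (count-prefix k (f ∘ (false ∷_))))
      (sym (sum-allVertices-suc {k} (λ x → count (λ v → f (x ++ v))))))

glue : VSet n → VSet n → VSet (suc n)
glue X Y (b ∷ v) = if b then X v else Y v

forallSetsᵇ : ∀ n → (VSet n → Bool) → Bool
forallSetsᵇ zero    P = P (const true) ∧ P (const false)
forallSetsᵇ (suc n) P = forallSetsᵇ n λ X → forallSetsᵇ n λ Y → P (glue X Y)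

-- At every closed vertex `canonical X` computes to `X v`, so for a test P that only evaluates
-- its argument at closed vertices, T (P (canonical X)) and T (P X) are the same type.
canonical : VSet n → VSet n
canonical {zero}  X = const (X [])
canonical {suc n} X = glue (canonical (X ∘ (true ∷_))) (canonical (X ∘ (false ∷_)))

forallSetsᵇ-sound : ∀ n (P : VSet n → Bool) → T (forallSetsᵇ n P) → ∀ X → T (P (canonical X))
forallSetsᵇ-sound zero P holds X with X []
... | true  = proj₁ (Equivalence.to T-∧ holds)
... | false = proj₂ (Equivalence.to T-∧ holds)
forallSetsᵇ-sound (suc n) P holds X =
  forallSetsᵇ-sound n (λ Y → P (glue X₁ Y))
    (forallSetsᵇ-sound n (λ Y → forallSetsᵇ n (λ Z → P (glue Y Z))) holds (X ∘ (true ∷_)))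
    (X ∘ (false ∷_))
  where X₁ = canonical (X ∘ (true ∷_))

_≟ᵛ_ : DecidableEquality (Vertex n)
_≟ᵛ_ = ≡-dec _≟ᵇ_

Triple : ℕ → Set
Triple n = Vertex n × Vertex n × Vertex n

tripleSet : Triple n → VSet n
tripleSet (p , q , r) v = does (v ≟ᵛ p) ∨ does (v ≟ᵛ q) ∨ does (v ≟ᵛ r)

∈-tripleSet⁻ : ∀ {p q r : Vertex n} v → v ∈V tripleSet (p , q , r) → v ≡ p ⊎ v ≡ q ⊎ v ≡ r
∈-tripleSet⁻ {p = p} {q} {r} v v∈t with v ≟ᵛ p | v ≟ᵛ q | v ≟ᵛ r
... | yes v≡p | _       | _       = inj₁ v≡p
... | no _    | yes v≡q | _       = inj₂ (inj₁ v≡q)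
... | no _    | no _    | yes v≡r = inj₂ (inj₂ v≡r)
... | no _    | no _    | no _    with () ← v∈t

∈-tripleSet⁺ : ∀ {v} (p q r : Vertex n) → v ≡ p ⊎ v ≡ q ⊎ v ≡ r → v ∈V tripleSet (p , q , r)
∈-tripleSet⁺ p q r (inj₁ refl) rewrite dec-true (p ≟ᵛ p) refl = refl
∈-tripleSet⁺ p q r (inj₂ (inj₁ refl)) rewrite dec-true (q ≟ᵛ q) refl = ∨-zeroʳ (does (q ≟ᵛ p))
∈-tripleSet⁺ p q r (inj₂ (inj₂ refl))
  rewrite dec-true (r ≟ᵛ r) refl | ∨-zeroʳ (does (r ≟ᵛ q)) = ∨-zeroʳ (does (r ≟ᵛ p))

tripleSet-⊆ : ∀ {X : VSet n} {p q r} → p ∈V X → q ∈V X → r ∈V X → tripleSet (p , q , r) ⊆V X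
tripleSet-⊆ p∈X q∈X r∈X v v∈t with ∈-tripleSet⁻ v v∈t
... | inj₁ refl        = p∈X
... | inj₂ (inj₁ refl) = q∈X
... | inj₂ (inj₂ refl) = r∈X

bdiff-comm : ∀ a b → bdiff a b ≡ bdiff b a
bdiff-comm true  true  = refl
bdiff-comm true  false = refl
bdiff-comm false true  = refl
bdiff-comm false false = refl

hamming-comm : (u v : Vertex n) → hamming u v ≡ hamming v u
hamming-comm []      []      = refl
hamming-comm (a ∷ u) (b ∷ v) = cong₂ _+_ (bdiff-comm a b) (hamming-comm u v)

Adj-sym : {u v : Vertex n} → Adj u v → Adj v u
Adj-sym {u = u} {v} u~v = trans (hamming-comm v u) u~v

_◅◅_ : ∀ {X : VSet n} {u w v} → WalkIn X u w → WalkIn X w v → WalkIn X u v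
here _          ◅◅ w→v = w→v
step u∈X u~u′ w ◅◅ w→v = step u∈X u~u′ (w ◅◅ w→v)

IsPath : Triple n → Set
IsPath t@(p , q , r) = Adj p q × Adj q r × size (tripleSet t) ≡ 3

isPath? : (t : Triple n) → Dec (IsPath t)
isPath? t@(p , q , r) = (hamming p q ≟ 1) ×-dec (hamming q r ≟ 1) ×-dec (size (tripleSet t) ≟ 3)

pathEgg : (t : Triple n) → IsPath t → Egg (E3 n) (tripleSet t)
pathEgg t@(p , q , r) (p~q , q~r , size≡3) =
  size≡3 , (p , p∈t) , λ u v u∈t v∈t → toMiddle u∈t ◅◅ fromMiddle v∈t
  where
  p∈t : p ∈V tripleSet t
  p∈t = ∈-tripleSet⁺ p q r (inj₁ refl)
  q∈t : q ∈V tripleSet t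
  q∈t = ∈-tripleSet⁺ p q r (inj₂ (inj₁ refl))
  r∈t : r ∈V tripleSet t
  r∈t = ∈-tripleSet⁺ p q r (inj₂ (inj₂ refl))
  toMiddle : ∀ {u} → u ∈V tripleSet t → WalkIn (tripleSet t) u q
  toMiddle {u} u∈t with ∈-tripleSet⁻ u u∈t
  ... | inj₁ refl        = step p∈t p~q (here q∈t)
  ... | inj₂ (inj₁ refl) = here q∈t
  ... | inj₂ (inj₂ refl) = step r∈t (Adj-sym {u = q} q~r) (here q∈t)
  fromMiddle : ∀ {v} → v ∈V tripleSet t → WalkIn (tripleSet t) q v
  fromMiddle {v} v∈t with ∈-tripleSet⁻ v v∈t
  ... | inj₁ refl        = step q∈t (Adj-sym {u = p} p~q) (here p∈t)
  ... | inj₂ (inj₁ refl) = here q∈t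
  ... | inj₂ (inj₂ refl) = step q∈t q~r (here r∈t)

meetsᵇ : VSet n → Triple n → Bool
meetsᵇ X (p , q , r) = X p ∨ X q ∨ X r

hitting-meets-path : ∀ {X : VSet n} → Hitting (E3 n) X → ∀ t → IsPath t → T (meetsᵇ X t)
hitting-meets-path {X = X} hit t@(p , q , r) path with hit (tripleSet t) (pathEgg t path)
... | v , v∈X , v∈t = meets (∈-tripleSet⁻ v v∈t) (Equivalence.from T-≡ v∈X)
  where
  ∨-intro : ∀ {a b} → T a ⊎ T b → T (a ∨ b)
  ∨-intro = Equivalence.from T-∨
  meets : ∀ {v} → v ≡ p ⊎ v ≡ q ⊎ v ≡ r → T (X v) → T (meetsᵇ X t)
  meets (inj₁ refl)        Xv = ∨-intro (inj₁ Xv)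
  meets (inj₂ (inj₁ refl)) Xv = ∨-intro {X p} (inj₂ (∨-intro (inj₁ Xv)))
  meets (inj₂ (inj₂ refl)) Xv = ∨-intro {X p} (inj₂ (∨-intro {X q} (inj₂ Xv)))

-- Q₂ is the 4-cycle c₀ c₁ c₂ c₃, so its four 3-vertex paths are all of its 3-subsets.
squarePaths : List (Triple 2)
squarePaths = (c₀ , c₁ , c₂) ∷ (c₁ , c₂ , c₃) ∷ (c₂ , c₃ , c₀) ∷ (c₃ , c₀ , c₁) ∷ []
  where
  c₀ = true ∷ true ∷ []
  c₁ = true ∷ false ∷ []
  c₂ = false ∷ false ∷ []
  c₃ = false ∷ true ∷ []

square-hitting-bound : (X : VSet 2) → T (all (meetsᵇ X) squarePaths) → 2 ≤ size X
square-hitting-bound X meets =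
  ≤ᵇ⇒≤ 2 (size X) (T-not-∨ (forallSetsᵇ-sound 2 check all-checked X) meets)
  where
  check : VSet 2 → Bool
  check Y = not (all (meetsᵇ Y) squarePaths) ∨ (2 ≤ᵇ size Y)
  all-checked : T (forallSetsᵇ 2 check)
  all-checked = _

prefixed : ∀ {k m} → Vertex k → Triple m → Triple (k + m)
prefixed x (p , q , r) = x ++ p , x ++ q , x ++ r

squarePaths-prefixed : (x : Vertex 2) → All IsPath (map (prefixed x) squarePaths)
squarePaths-prefixed x@(true  ∷ true  ∷ []) = from-yes (all? isPath? (map (prefixed x) squarePaths))
squarePaths-prefixed x@(true  ∷ false ∷ []) = from-yes (all? isPath? (map (prefixed x) squarePaths))
squarePaths-prefixed x@(false ∷ true  ∷ []) = from-yes (all? isPath? (map (prefixed x) squarePaths))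
squarePaths-prefixed x@(false ∷ false ∷ []) = from-yes (all? isPath? (map (prefixed x) squarePaths))

hitting-bound : ∀ X → Hitting (E3 4) X → 8 ≤ size X
hitting-bound X hit = begin
  8                                                         ≤⟨ sum-map-mono square-bound (allVertices 2) ⟩
  sum (map (λ x → size (λ v → X (x ++ v))) (allVertices 2)) ≡⟨ count-prefix 2 X ⟨
  size X                                                    ∎
  where
  open ≤-Reasoning
  square-bound : ∀ x → 2 ≤ size (λ v → X (x ++ v))
  square-bound x = square-hitting-bound (λ v → X (x ++ v))
    (all⁻ (meetsᵇ X) (All-map (hitting-meets-path hit _) (squarePaths-prefixed x)))

slice : Bool → VSet (suc n) → VSet n
slice b A v = A (b ∷ v)

_∖_ : VSet n → VSet n → VSet n
(X ∖ Y) v = X v ∧ not (Y v)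

boundary : VSet n → ℕ
boundary {zero}  A = 0
boundary {suc n} A = (boundary A₁ + size (A₁ ∖ A₀)) + (boundary A₀ + size (A₀ ∖ A₁))
  where
  A₁ = slice true A
  A₀ = slice false A

adjᵇ : Vertex n → Vertex n → Bool
adjᵇ u v = hamming u v ≡ᵇ 1

outDegree : VSet n → Vertex n → ℕ
outDegree A u = count (λ v → if A v then false else adjᵇ u v)

cutSize′ : VSet n → ℕ
cutSize′ {n} A = sum (map (λ u → if A u then outDegree A u else 0) (allVertices n))

-- `cutSize` tests adjacency with a local `with` on `hamming u v`, which only computes at closed
-- vertices; in Q₄ every vertex is closed, so it unfolds to `cutSize′`.
cutSize≡cutSize′ : (A : VSet 4) → cutSize A ≡ cutSize′ A
cutSize≡cutSize′ A = refl

count-hamming-zero : (X : VSet n) (u : Vertex n) →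
  count (λ v → if X v then false else hamming u v ≡ᵇ 0) ≡ (if X u then 0 else 1)
count-hamming-zero {zero} X [] with X []
... | true  = refl
... | false = refl
count-hamming-zero {suc n} X (true ∷ u) =
  trans (count-suc {n} _)
    (trans (cong₂ _+_ (count-hamming-zero (slice true X) u) (count-false (λ v → if-eta (X (false ∷ v)))))
      (+-identityʳ _))
count-hamming-zero {suc n} X (false ∷ u) =
  trans (count-suc {n} _)
    (cong₂ _+_ (count-false (λ v → if-eta (X (true ∷ v)))) (count-hamming-zero (slice false X) u))

outDegree-∷ : ∀ b (A : VSet (suc n)) u →
  outDegree A (b ∷ u) ≡ outDegree (slice b A) u + (if slice (not b) A u then 0 else 1)
outDegree-∷ {n} true A u =
  trans (count-suc {n} _) (cong (outDegree (slice true A) u +_) (count-hamming-zero (slice false A) u))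
outDegree-∷ {n} false A u =
  trans (count-suc {n} _)
    (trans (cong (_+ outDegree (slice false A) u) (count-hamming-zero (slice true A) u))
      (+-comm (if A (true ∷ u) then 0 else 1) _))

cutSize′-half : ∀ b (A : VSet (suc n)) →
  sum (map (λ u → if slice b A u then outDegree A (b ∷ u) else 0) (allVertices n))
    ≡ cutSize′ (slice b A) + size (slice b A ∖ slice (not b) A)
cutSize′-half {n} b A = begin
  sum (map (λ u → if A₁ u then outDegree A (b ∷ u) else 0) vs)
    ≡⟨ sum-map-cong split vs ⟩
  sum (map (λ u → (if A₁ u then outDegree A₁ u else 0) + (if (A₁ ∖ A₀) u then 1 else 0)) vs)
    ≡⟨ sum-map-+ _ _ vs ⟩
  cutSize′ A₁ + size (A₁ ∖ A₀)
    ∎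
  where
  open ≡-Reasoning
  vs = allVertices n
  A₁ = slice b A
  A₀ = slice (not b) A
  split : ∀ u → (if A₁ u then outDegree A (b ∷ u) else 0)
              ≡ (if A₁ u then outDegree A₁ u else 0) + (if (A₁ ∖ A₀) u then 1 else 0)
  split u rewrite outDegree-∷ b A u | if-∧ (A₁ u) {not (A₀ u)} {1} {0} | if-not (A₀ u) {1} {0} with A₁ u
  ... | true  = refl
  ... | false = refl

cutSize′≡boundary : (A : VSet n) → cutSize′ A ≡ boundary A
cutSize′≡boundary {zero} A with A []
... | true  = refl
... | false = refl
cutSize′≡boundary {suc n} A =
  trans (sum-allVertices-suc {n} _)
    (cong₂ _+_ (trans (cutSize′-half true A) (cong (_+ size (A₁ ∖ A₀)) (cutSize′≡boundary A₁)))
               (trans (cutSize′-half false A) (cong (_+ size (A₀ ∖ A₁)) (cutSize′≡boundary A₀))))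
  where
  A₁ = slice true A
  A₀ = slice false A

egg-⊆⇒3≤size : ∀ {X A : VSet n} → Egg (E3 n) X → X ⊆V A → 3 ≤ size A
egg-⊆⇒3≤size {A = A} (size≡3 , _) X⊆A = subst (_≤ size A) size≡3 (count-mono X⊆A)

size-complement : (X : VSet n) → size X + size (complement X) ≡ 2 ^ n
size-complement {zero} X with X []
... | true  = refl
... | false = refl
size-complement {suc n} X = begin
  size X + size (complement X)
    ≡⟨ cong₂ _+_ (count-suc X) (count-suc (complement X)) ⟩
  (size X₁ + size X₀) + (size (complement X₁) + size (complement X₀))
    ≡⟨ interchange (size X₁) (size X₀) _ _ ⟩
  (size X₁ + size (complement X₁)) + (size X₀ + size (complement X₀))
    ≡⟨ cong₂ _+_ (size-complement X₁) (size-complement X₀) ⟩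
  2 ^ n + 2 ^ n
    ≡⟨ cong (2 ^ n +_) (+-identityʳ (2 ^ n)) ⟨
  2 ^ suc n
    ∎
  where
  open ≡-Reasoning
  X₁ = slice true X
  X₀ = slice false X

size-∖ : (X Y : VSet n) → size X ≤ size Y + size (X ∖ Y)
size-∖ {zero} X Y with X [] | Y []
... | true  | true  = s≤s z≤n
... | true  | false = ≤-refl
... | false | _     = z≤n
size-∖ {suc n} X Y = begin
  size X                                                       ≡⟨ count-suc X ⟩
  size X₁ + size X₀                                            ≤⟨ +-mono-≤ (size-∖ X₁ Y₁) (size-∖ X₀ Y₀) ⟩
  (size Y₁ + size (X₁ ∖ Y₁)) + (size Y₀ + size (X₀ ∖ Y₀))      ≡⟨ interchange (size Y₁) _ _ _ ⟩
  (size Y₁ + size Y₀) + (size (X₁ ∖ Y₁) + size (X₀ ∖ Y₀))      ≡⟨ cong₂ _+_ (count-suc Y) (count-suc (X ∖ Y)) ⟨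
  size Y + size (X ∖ Y)                                        ∎
  where
  open ≤-Reasoning
  X₁ = slice true X
  X₀ = slice false X
  Y₁ = slice true Y
  Y₀ = slice false Y

-- The edge-isoperimetric profile of Q₃: the least boundary of a k-vertex set.
minBoundary₃ : ℕ → ℕ
minBoundary₃ 1 = 3
minBoundary₃ 2 = 4
minBoundary₃ 3 = 5
minBoundary₃ 4 = 4
minBoundary₃ 5 = 5
minBoundary₃ 6 = 4
minBoundary₃ 7 = 3
minBoundary₃ _ = 0

minBoundary₃-≤ : (X : VSet 3) → minBoundary₃ (size X) ≤ boundary X
minBoundary₃-≤ X =
  ≤ᵇ⇒≤ (minBoundary₃ (size X)) (boundary X) (forallSetsᵇ-sound 3 check all-checked X)
  where
  check : VSet 3 → Bool
  check Y = minBoundary₃ (size Y) ≤ᵇ boundary Y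
  all-checked : T (forallSetsᵇ 3 check)
  all-checked = _

HalvesBound : ℕ → ℕ → Set
HalvesBound a b = 3 ≤ a + b → a + b ≤ 13 → 8 ≤ (minBoundary₃ a + (a ∸ b)) + (minBoundary₃ b + (b ∸ a))

halvesBound : ∀ a b → HalvesBound a b
halvesBound a b 3≤a+b a+b≤13 =
  from-yes (allUpTo? (λ a → allUpTo? (halvesBound? a) 14) 14) a<14 b<14 3≤a+b a+b≤13
  where
  halvesBound? : ∀ a b → Dec (HalvesBound a b)
  halvesBound? a b = (3 ≤? a + b) →-dec (a + b ≤? 13)
                   →-dec (8 ≤? (minBoundary₃ a + (a ∸ b)) + (minBoundary₃ b + (b ∸ a)))
  a<14 : a < 14
  a<14 = s≤s (≤-trans (m≤m+n a b) a+b≤13)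
  b<14 : b < 14
  b<14 = s≤s (≤-trans (m≤n+m b a) a+b≤13)

cut-bound : ∀ A → EggCut (E3 4) A → 8 ≤ cutSize A
cut-bound A ((X , X-egg , X⊆A) , (Y , Y-egg , Y⊆Aᶜ)) = begin
  8
    ≤⟨ halvesBound a b 3≤a+b a+b≤13 ⟩
  (minBoundary₃ a + (a ∸ b)) + (minBoundary₃ b + (b ∸ a))
    ≤⟨ +-mono-≤ (+-mono-≤ (minBoundary₃-≤ A₁) (m≤n+o⇒m∸n≤o a b (size-∖ A₁ A₀)))
                (+-mono-≤ (minBoundary₃-≤ A₀) (m≤n+o⇒m∸n≤o b a (size-∖ A₀ A₁))) ⟩
  boundary A
    ≡⟨ trans (cutSize≡cutSize′ A) (cutSize′≡boundary A) ⟨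
  cutSize A
    ∎
  where
  open ≤-Reasoning
  A₁ = slice true A
  A₀ = slice false A
  a = size A₁
  b = size A₀
  3≤a+b : 3 ≤ a + b
  3≤a+b = subst (3 ≤_) (count-suc A) (egg-⊆⇒3≤size X-egg X⊆A)
  a+b≤13 : a + b ≤ 13
  a+b≤13 = subst (_≤ 13) (count-suc A)
    (m+n≤o⇒m≤o∸n (size A)
      (subst (size A + 3 ≤_) (size-complement A) (+-monoʳ-≤ (size A) (egg-⊆⇒3≤size Y-egg Y⊆Aᶜ))))

firstCoordinate : VSet 4
firstCoordinate (b ∷ _) = b

firstCoordinate-eggCut : EggCut (E3 4) firstCoordinate
firstCoordinate-eggCut =
  (tripleSet upper , pathEgg upper (from-yes (isPath? upper)) , tripleSet-⊆ refl refl refl) ,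
  (tripleSet lower , pathEgg lower (from-yes (isPath? lower)) , tripleSet-⊆ refl refl refl)
  where
  upper lower : Triple 4
  upper = (true  ∷ false ∷ false ∷ false ∷ [])
        , (true  ∷ true  ∷ false ∷ false ∷ [])
        , (true  ∷ true  ∷ true  ∷ false ∷ [])
  lower = (false ∷ false ∷ false ∷ false ∷ [])
        , (false ∷ true  ∷ false ∷ false ∷ [])
        , (false ∷ true  ∷ true  ∷ false ∷ [])

lemma3p12 : ScrambleNorm (E3 4) 8
lemma3p12 = inj₂ (firstCoordinate , firstCoordinate-eggCut , refl) , hitting-bound , cut-bound
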